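{- For every $\pi\in PM_{2n}$, $$\mathrm{tvd}(\pi)=2\binom{n}{2}-2\,\mathrm{al}(\pi)=2\big(\mathrm{cr}(\pi)+\mathrm{ne}(\pi)\big).$$
   Context: A perfect matching on $[2n]$ is a set partition of $[2n]$ into blocks of size $2$; $PM_{2n}$ is the set of them. A block $\{i<j\}$ is an arc $(i,j)$ with span $j-i-1$. For a vertex $v$, $\mathrm{depth}(v)$ is the number of arcs $(i,j)$ with $i<v<j$. The total vertex depth is $\mathrm{tvd}(\pi)=\sum_{v=1}^{2n}\mathrm{depth}(v)$ (equivalently, the sum of the spans of all arcs). For two arcs $(i,j)$, $(k,l)$ with $i<k$, the pair is a crossing if $i<k<j<l$, a nesting if $i<k<l<j$, and an alignment if $i<j<k<l$; $\mathrm{cr}(\pi)$, $\mathrm{ne}(\pi)$, $\mathrm{al}(\pi)$ are the numbers of crossings, nestings and alignments. -}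

module Defs where

open import Data.Nat using (ℕ; _+_; _*_; _<_; _<?_)
open import Data.Nat.Combinatorics using (_C_)
open import Data.Product using (_×_; _,_; proj₁; proj₂)
open import Data.List using (List; []; _∷_; length; map; filter; applyUpTo; concatMap; cartesianProduct)
open import Data.Nat.ListAction using (sum)
open import Data.List.Relation.Unary.All using (All)
open import Data.List.Relation.Binary.Permutation.Propositional using (_↭_)
open import Relation.Nullary.Decidable using (_×-dec_)

Arc : Set
Arc = ℕ × ℕ

endpoints : List Arc → List ℕ
endpoints = concatMap (λ a → proj₁ a ∷ proj₂ a ∷ [])

vertices : ℕ → List ℕ
vertices n = applyUpTo (λ k → k + 1) (2 * n)

-- The order of arcs in the list is
-- irrelevant to all statistics below.
record PM (n : ℕ) : Set where
  constructor mkPM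
  field
    arcs     : List Arc
    ordered  : All (λ a → proj₁ a < proj₂ a) arcs
    covers   : endpoints arcs ↭ vertices n

open PM public

depth : List Arc → ℕ → ℕ
depth as v = length (filter (λ a → (proj₁ a <? v) ×-dec (v <? proj₂ a)) as)

tvd : {n : ℕ} → PM n → ℕ
tvd {n} π = sum (map (depth (arcs π)) (vertices n))

pairs : List Arc → List (Arc × Arc)
pairs as = cartesianProduct as as

cr : {n : ℕ} → PM n → ℕ
cr π = length (filter (λ p → let a = proj₁ p ; b = proj₂ p in
          (proj₁ a <? proj₁ b) ×-dec ((proj₁ b <? proj₂ a) ×-dec (proj₂ a <? proj₂ b)))
        (pairs (arcs π)))

ne : {n : ℕ} → PM n → ℕ
ne π = length (filter (λ p → let a = proj₁ p ; b = proj₂ p in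
          (proj₁ a <? proj₁ b) ×-dec ((proj₁ b <? proj₂ b) ×-dec (proj₂ b <? proj₂ a)))
        (pairs (arcs π)))

al : {n : ℕ} → PM n → ℕ
al π = length (filter (λ p → let a = proj₁ p ; b = proj₂ p in
          (proj₁ a <? proj₂ a) ×-dec ((proj₂ a <? proj₁ b) ×-dec (proj₁ b <? proj₂ b)))
        (pairs (arcs π)))

module Submission where

-- Writing depth as a sum over arcs and exchanging the order of summation,
-- tvd(π) = Σ_{a,b} (number of endpoints of b strictly inside a).  For a pair
-- of distinct arcs this number is 2 if b nests in a, 1 if a and b cross, and
-- 0 otherwise, which gives tvd = 2(cr + ne).  Moreover every pair of distinct
-- arcs crosses, nests or aligns in exactly one of its two orientations, so
-- cr + ne + al = C(n,2).  Both facts about a pair of arcs depend only on the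
-- relative order of their four endpoints and are checked on the six possible
-- orders.

open import Defs
open import Data.Bool using (Bool; true; false; _∧_)
open import Data.Empty using (⊥-elim)
open import Data.Fin using (Fin; toℕ)
open import Data.Fin.Patterns using (0F; 1F; 2F; 3F)
open import Data.List using (List; []; _∷_; _++_; length; map; filter; concatMap; cartesianProduct)
open import Data.List.Properties using (map-++; map-∘; map-cong; map-cong-local; length-applyUpTo)
open import Data.List.Relation.Unary.All as All using (All; []; _∷_)
open import Data.List.Relation.Unary.AllPairs using (AllPairs; []; _∷_)
open import Data.List.Relation.Unary.Unique.Propositional using (Unique)
open import Data.List.Relation.Unary.Unique.Propositional.Properties using (applyUpTo⁺₁)
open import Data.List.Relation.Binary.Permutation.Propositional using (_↭_; ↭-sym; ↭⇒↭ₛ)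
open import Data.List.Relation.Binary.Permutation.Propositional.Properties using (map⁺; ↭-length)
open import Data.Nat using (ℕ; suc; _+_; _*_; _<_; _≤_; _<?_)
open import Data.Nat.Combinatorics using (_C_; nC1≡n; nCk+nC[k+1]≡[n+1]C[k+1])
open import Data.Nat.ListAction using (sum)
open import Data.Nat.ListAction.Properties using (sum-++; sum-↭)
open import Data.Nat.Properties using (<-trans; <⇒≤; <⇒≢; <⇒≱; ≤-refl; <-cmp; +-identityʳ; +-cancelʳ-≡; *-zeroʳ; *-suc; *-distribˡ-+; *-cancelˡ-≡)
open import Algebra.Properties.CommutativeSemigroup Data.Nat.Properties.+-commutativeSemigroup using (interchange)
open import Data.Nat.Tactic.RingSolver using (solve-∀)
open import Data.Product using (_×_; _,_; proj₁; proj₂)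
open import Relation.Binary using (Symmetric; tri<; tri≈; tri>)
open import Relation.Binary.PropositionalEquality using (_≡_; _≢_; refl; sym; trans; cong; cong₂; setoid; module ≡-Reasoning)
open import Relation.Nullary using (does)
open import Relation.Nullary.Decidable using (dec-true; dec-false)
open import Relation.Unary using (Decidable)
open import Data.List.Relation.Binary.Permutation.Setoid.Properties (setoid ℕ) using (Unique-resp-↭)

open ≡-Reasoning

private variable A B : Set

𝟙 : Bool → ℕ
𝟙 true  = 1
𝟙 false = 0

∑ : List A → (A → ℕ) → ℕ
∑ xs f = sum (map f xs)

syntax ∑ xs (λ x → e) = ∑[ x ∈ xs ] e

length-filter≡∑ : {P : A → Set} (P? : Decidable P) (xs : List A) →
                  length (filter P? xs) ≡ ∑[ x ∈ xs ] 𝟙 (does (P? x))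
length-filter≡∑ P? []       = refl
length-filter≡∑ P? (x ∷ xs) with does (P? x)
... | true  = cong suc (length-filter≡∑ P? xs)
... | false = length-filter≡∑ P? xs

∑-cong : ∀ {f g : A → ℕ} (xs : List A) → (∀ x → f x ≡ g x) → ∑ xs f ≡ ∑ xs g
∑-cong xs f≗g = cong sum (map-cong f≗g xs)

∑-cong-local : ∀ {f g : A → ℕ} {xs : List A} → All (λ x → f x ≡ g x) xs → ∑ xs f ≡ ∑ xs g
∑-cong-local eqs = cong sum (map-cong-local eqs)

∑-++ : ∀ (xs ys : List A) (f : A → ℕ) → ∑ (xs ++ ys) f ≡ ∑ xs f + ∑ ys f
∑-++ xs ys f = trans (cong sum (map-++ f xs ys)) (sum-++ (map f xs) (map f ys))

∑-↭ : ∀ {xs ys : List A} (f : A → ℕ) → xs ↭ ys → ∑ xs f ≡ ∑ ys f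
∑-↭ f xs↭ys = sum-↭ (map⁺ f xs↭ys)

∑-distrib-+ : ∀ (xs : List A) (f g : A → ℕ) → ∑[ x ∈ xs ] (f x + g x) ≡ ∑ xs f + ∑ xs g
∑-distrib-+ []       f g = refl
∑-distrib-+ (x ∷ xs) f g = begin
  (f x + g x) + ∑[ y ∈ xs ] (f y + g y) ≡⟨ cong (f x + g x +_) (∑-distrib-+ xs f g) ⟩
  (f x + g x) + (∑ xs f + ∑ xs g)       ≡⟨ interchange (f x) (g x) _ _ ⟩
  (f x + ∑ xs f) + (g x + ∑ xs g)       ∎

∑-*ˡ : ∀ (xs : List A) (k : ℕ) (f : A → ℕ) → ∑[ x ∈ xs ] (k * f x) ≡ k * ∑ xs f
∑-*ˡ []       k f = sym (*-zeroʳ k)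
∑-*ˡ (x ∷ xs) k f = trans (cong (k * f x +_) (∑-*ˡ xs k f)) (sym (*-distribˡ-+ k (f x) _))

∑-zero : ∀ (xs : List A) → ∑[ x ∈ xs ] 0 ≡ 0
∑-zero []       = refl
∑-zero (x ∷ xs) = ∑-zero xs

∑-one : ∀ (xs : List A) → ∑[ x ∈ xs ] 1 ≡ length xs
∑-one []       = refl
∑-one (x ∷ xs) = cong suc (∑-one xs)

∑-map : ∀ (h : B → A) (xs : List B) (f : A → ℕ) → ∑ (map h xs) f ≡ ∑[ x ∈ xs ] f (h x)
∑-map h xs f = cong sum (sym (map-∘ xs))

∑-concatMap : ∀ (g : B → List A) (xs : List B) (f : A → ℕ) →
              ∑ (concatMap g xs) f ≡ ∑[ x ∈ xs ] ∑ (g x) f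
∑-concatMap g []       f = refl
∑-concatMap g (x ∷ xs) f = trans (∑-++ (g x) (concatMap g xs) f) (cong (∑ (g x) f +_) (∑-concatMap g xs f))

∑-comm : ∀ (xs : List A) (ys : List B) (f : A → B → ℕ) →
         ∑[ x ∈ xs ] ∑[ y ∈ ys ] f x y ≡ ∑[ y ∈ ys ] ∑[ x ∈ xs ] f x y
∑-comm []       ys f = sym (∑-zero ys)
∑-comm (x ∷ xs) ys f = trans (cong (∑ ys (f x) +_) (∑-comm xs ys f))
                             (sym (∑-distrib-+ ys (f x) (λ y → ∑[ x′ ∈ xs ] f x′ y)))

∑-cartesianProduct : ∀ (xs : List A) (ys : List B) (f : A × B → ℕ) →
                     ∑ (cartesianProduct xs ys) f ≡ ∑[ x ∈ xs ] ∑[ y ∈ ys ] f (x , y)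
∑-cartesianProduct []       ys f = refl
∑-cartesianProduct (x ∷ xs) ys f = begin
  ∑ (map (x ,_) ys ++ cartesianProduct xs ys) f          ≡⟨ ∑-++ (map (x ,_) ys) _ f ⟩
  ∑ (map (x ,_) ys) f + ∑ (cartesianProduct xs ys) f     ≡⟨ cong₂ _+_ (∑-map (x ,_) ys f) (∑-cartesianProduct xs ys f) ⟩
  ∑[ y ∈ ys ] f (x , y) + ∑[ x′ ∈ xs ] ∑[ y ∈ ys ] f (x′ , y) ∎

∑∑ : List A → (A → A → ℕ) → ℕ
∑∑ xs F = ∑[ x ∈ xs ] ∑[ y ∈ xs ] F x y

symmetrised : (A → A → ℕ) → A → A → ℕ
symmetrised F x y = F x y + F y x

∑∑-cons : ∀ (x : A) xs F →
          ∑∑ (x ∷ xs) F ≡ (F x x + ∑ xs (F x)) + (∑[ y ∈ xs ] F y x + ∑∑ xs F)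
∑∑-cons x xs F = cong (F x x + ∑ xs (F x) +_) (∑-distrib-+ xs (λ y → F y x) (λ y → ∑ xs (F y)))

∑∑-+ : ∀ (xs : List A) F G → ∑∑ xs (λ x y → F x y + G x y) ≡ ∑∑ xs F + ∑∑ xs G
∑∑-+ xs F G = trans (∑-cong xs (λ x → ∑-distrib-+ xs (F x) (G x))) (∑-distrib-+ xs _ _)

∑∑-*ˡ : ∀ (xs : List A) k F → ∑∑ xs (λ x y → k * F x y) ≡ k * ∑∑ xs F
∑∑-*ˡ xs k F = trans (∑-cong xs (λ x → ∑-*ˡ xs k (F x))) (∑-*ˡ xs k _)

∑∑-symmetrised : ∀ (xs : List A) F → ∑∑ xs (symmetrised F) ≡ 2 * ∑∑ xs F
∑∑-symmetrised xs F = begin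
  ∑∑ xs (symmetrised F)                            ≡⟨ ∑∑-+ xs F (λ x y → F y x) ⟩
  ∑∑ xs F + ∑[ x ∈ xs ] ∑[ y ∈ xs ] F y x          ≡⟨ cong (∑∑ xs F +_) (∑-comm xs xs (λ x y → F y x)) ⟩
  ∑∑ xs F + ∑∑ xs F                                ≡⟨ cong (∑∑ xs F +_) (sym (+-identityʳ _)) ⟩
  2 * ∑∑ xs F                                      ∎

module _ {P : A → Set} {R : A → A → Set} (R-sym : Symmetric R) where

  ∑∑-cong-pairwise : ∀ {F G : A → A → ℕ} →
    (∀ {x} → P x → F x x ≡ G x x) →
    (∀ {x y} → P x → P y → R x y → F x y ≡ G x y) →
    ∀ {xs} → All P xs → AllPairs R xs → ∑∑ xs F ≡ ∑∑ xs G
  ∑∑-cong-pairwise         diag off {[]}     []         []         = refl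
  ∑∑-cong-pairwise {F} {G} diag off {x ∷ xs} (px ∷ pxs) (rx ∷ rxs) = begin
    ∑∑ (x ∷ xs) F
      ≡⟨ ∑∑-cons x xs F ⟩
    (F x x + ∑ xs (F x)) + (∑[ y ∈ xs ] F y x + ∑∑ xs F)
      ≡⟨ cong₂ _+_ (cong₂ _+_ (diag px) row) (cong₂ _+_ column rest) ⟩
    (G x x + ∑ xs (G x)) + (∑[ y ∈ xs ] G y x + ∑∑ xs G)
      ≡⟨ sym (∑∑-cons x xs G) ⟩
    ∑∑ (x ∷ xs) G ∎
    where
    row : ∑ xs (F x) ≡ ∑ xs (G x)
    row = ∑-cong-local (All.zipWith (λ (py , r) → off px py r) (pxs , rx))
    column : ∑[ y ∈ xs ] F y x ≡ ∑[ y ∈ xs ] G y x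
    column = ∑-cong-local (All.zipWith (λ (py , r) → off py px (R-sym r)) (pxs , rx))
    rest : ∑∑ xs F ≡ ∑∑ xs G
    rest = ∑∑-cong-pairwise diag off pxs rxs

  ∑∑-offDiagonalOnes : ∀ {F : A → A → ℕ} →
    (∀ {x} → P x → F x x ≡ 0) →
    (∀ {x y} → P x → P y → R x y → F x y ≡ 1) →
    ∀ {xs} → All P xs → AllPairs R xs → ∑∑ xs F ≡ 2 * (length xs C 2)
  ∑∑-offDiagonalOnes     diag off {[]}     []         []         = refl
  ∑∑-offDiagonalOnes {F} diag off {x ∷ xs} (px ∷ pxs) (rx ∷ rxs) = begin
    ∑∑ (x ∷ xs) F
      ≡⟨ ∑∑-cons x xs F ⟩
    (F x x + ∑ xs (F x)) + (∑[ y ∈ xs ] F y x + ∑∑ xs F)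
      ≡⟨ cong₂ _+_ (cong₂ _+_ (diag px) row) (cong₂ _+_ column rest) ⟩
    m + (m + 2 * (m C 2))
      ≡⟨ double-+ m (m C 2) ⟩
    2 * (m + m C 2)
      ≡⟨ cong (λ t → 2 * (t + m C 2)) (sym (nC1≡n m)) ⟩
    2 * (m C 1 + m C 2)
      ≡⟨ cong (2 *_) (nCk+nC[k+1]≡[n+1]C[k+1] m 1) ⟩
    2 * (suc m C 2) ∎
    where
    m = length xs
    row : ∑ xs (F x) ≡ m
    row = trans (∑-cong-local (All.zipWith (λ (py , r) → off px py r) (pxs , rx))) (∑-one xs)
    column : ∑[ y ∈ xs ] F y x ≡ m
    column = trans (∑-cong-local (All.zipWith (λ (py , r) → off py px (R-sym r)) (pxs , rx))) (∑-one xs)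
    rest : ∑∑ xs F ≡ 2 * (m C 2)
    rest = ∑∑-offDiagonalOnes diag off pxs rxs
    double-+ : ∀ a b → a + (a + 2 * b) ≡ 2 * (a + b)
    double-+ = solve-∀

<-true : ∀ {a b} → a < b → does (a <? b) ≡ true
<-true {a} {b} = dec-true (a <? b)

≥-false : ∀ {a b} → b ≤ a → does (a <? b) ≡ false
≥-false {a} {b} b≤a = dec-false (a <? b) (λ a<b → <⇒≱ a<b b≤a)

between : ℕ → ℕ → ℕ → Bool
between a b c = does (a <? b) ∧ does (b <? c)

increasing : ℕ → ℕ → ℕ → ℕ → Bool
increasing a b c d = does (a <? b) ∧ between b c d

Ordered : Arc → Set
Ordered (i , j) = i < j

Disjoint : Arc → Arc → Set
Disjoint (i , j) (k , l) = i ≢ k × i ≢ l × j ≢ k × j ≢ l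

Disjoint-sym : Symmetric Disjoint
Disjoint-sym (i≢k , i≢l , j≢k , j≢l) =
  (λ e → i≢k (sym e)) , (λ e → j≢k (sym e)) , (λ e → i≢l (sym e)) , (λ e → j≢l (sym e))

encloses : Arc → ℕ → Bool
encloses (i , j) v = between i v j

enclosedEndpoints : Arc → Arc → ℕ
enclosedEndpoints a (k , l) = 𝟙 (encloses a k) + 𝟙 (encloses a l)

crossing nesting alignment : Arc → Arc → ℕ
crossing  (i , j) (k , l) = 𝟙 (increasing i k j l)
nesting   (i , j) (k , l) = 𝟙 (increasing i k l j)
alignment (i , j) (k , l) = 𝟙 (increasing i j k l)

relationCount : Arc → Arc → ℕ
relationCount a b = symmetrised crossing a b + symmetrised nesting a b + symmetrised alignment a b

PairIdentities : Arc → Arc → Set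
PairIdentities a b = (enclosedEndpoints a b ≡ symmetrised crossing a b + 2 * nesting a b) × (relationCount a b ≡ 1)

module OrderType {w x y z : ℕ} (w<x : w < x) (x<y : x < y) (y<z : y < z) where

  point : Fin 4 → ℕ
  point 0F = w
  point 1F = x
  point 2F = y
  point 3F = z

  private
    w<y : w < y
    w<y = <-trans w<x x<y
    x<z : x < z
    x<z = <-trans x<y y<z
    w<z : w < z
    w<z = <-trans w<x x<z

  compare-points : ∀ p q → does (point p <? point q) ≡ does (toℕ p <? toℕ q)
  compare-points 0F 0F = ≥-false (≤-refl {w})
  compare-points 0F 1F = <-true w<x
  compare-points 0F 2F = <-true w<y
  compare-points 0F 3F = <-true w<z
  compare-points 1F 0F = ≥-false (<⇒≤ w<x)
  compare-points 1F 1F = ≥-false (≤-refl {x})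
  compare-points 1F 2F = <-true x<y
  compare-points 1F 3F = <-true x<z
  compare-points 2F 0F = ≥-false (<⇒≤ w<y)
  compare-points 2F 1F = ≥-false (<⇒≤ x<y)
  compare-points 2F 2F = ≥-false (≤-refl {y})
  compare-points 2F 3F = <-true y<z
  compare-points 3F 0F = ≥-false (<⇒≤ w<z)
  compare-points 3F 1F = ≥-false (<⇒≤ x<z)
  compare-points 3F 2F = ≥-false (<⇒≤ y<z)
  compare-points 3F 3F = ≥-false (≤-refl {z})

  increasing-points : ∀ p q r s →
    increasing (point p) (point q) (point r) (point s) ≡ increasing (toℕ p) (toℕ q) (toℕ r) (toℕ s)
  increasing-points p q r s =
    cong₂ _∧_ (compare-points p q) (cong₂ _∧_ (compare-points q r) (compare-points r s))

  at ranks : Fin 4 → Fin 4 → Arc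
  at p q = point p , point q
  ranks p q = toℕ p , toℕ q

  Invariant : (Arc → Arc → ℕ) → Set
  Invariant F = ∀ p q r s → F (at p q) (at r s) ≡ F (ranks p q) (ranks r s)

  enclosedEndpoints-invariant : Invariant enclosedEndpoints
  enclosedEndpoints-invariant p q r s = cong₂ _+_
    (cong 𝟙 (cong₂ _∧_ (compare-points p r) (compare-points r q)))
    (cong 𝟙 (cong₂ _∧_ (compare-points p s) (compare-points s q)))

  crossing-invariant : Invariant crossing
  crossing-invariant p q r s = cong 𝟙 (increasing-points p r q s)

  nesting-invariant : Invariant nesting
  nesting-invariant p q r s = cong 𝟙 (increasing-points p r s q)

  alignment-invariant : Invariant alignment
  alignment-invariant p q r s = cong 𝟙 (increasing-points p q r s)

  symmetrised-invariant : ∀ {F} → Invariant F → Invariant (symmetrised F)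
  symmetrised-invariant inv p q r s = cong₂ _+_ (inv p q r s) (inv r s p q)

  transfer : ∀ {F G} → Invariant F → Invariant G → ∀ p q r s →
             F (ranks p q) (ranks r s) ≡ G (ranks p q) (ranks r s) → F (at p q) (at r s) ≡ G (at p q) (at r s)
  transfer invF invG p q r s eq = trans (invF p q r s) (trans eq (sym (invG p q r s)))

  relationCount-invariant : Invariant relationCount
  relationCount-invariant p q r s =
    cong₂ _+_ (cong₂ _+_ (symmetrised-invariant {crossing} crossing-invariant p q r s)
                         (symmetrised-invariant {nesting} nesting-invariant p q r s))
              (symmetrised-invariant {alignment} alignment-invariant p q r s)

  pairIdentities : ∀ p q r s → PairIdentities (ranks p q) (ranks r s) → PairIdentities (at p q) (at r s)
  pairIdentities p q r s (eq₁ , eq₂) =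
    transfer {F = enclosedEndpoints} {G = λ a b → symmetrised crossing a b + 2 * nesting a b} enclosedEndpoints-invariant
             (λ p q r s → cong₂ _+_ (symmetrised-invariant {crossing} crossing-invariant p q r s)
                                    (cong (2 *_) (nesting-invariant p q r s)))
             p q r s eq₁ ,
    transfer {F = relationCount} {G = λ _ _ → 1} relationCount-invariant (λ _ _ _ _ → refl) p q r s eq₂

data Interleaving (i j k l : ℕ) : Set where
  ijkl : i < j → j < k → k < l → Interleaving i j k l
  ikjl : i < k → k < j → j < l → Interleaving i j k l
  iklj : i < k → k < l → l < j → Interleaving i j k l
  kijl : k < i → i < j → j < l → Interleaving i j k l
  kilj : k < i → i < l → l < j → Interleaving i j k l
  klij : k < l → l < i → i < j → Interleaving i j k l

interleaving : ∀ {i j k l} → i < j → k < l → Disjoint (i , j) (k , l) → Interleaving i j k l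
interleaving {i} {j} {k} {l} i<j k<l (i≢k , i≢l , j≢k , j≢l) with <-cmp i k
... | tri≈ _ i≡k _ = ⊥-elim (i≢k i≡k)
... | tri< i<k _ _ with <-cmp j k
...   | tri< j<k _ _ = ijkl i<j j<k k<l
...   | tri≈ _ j≡k _ = ⊥-elim (j≢k j≡k)
...   | tri> _ _ k<j with <-cmp j l
...     | tri< j<l _ _ = ikjl i<k k<j j<l
...     | tri≈ _ j≡l _ = ⊥-elim (j≢l j≡l)
...     | tri> _ _ l<j = iklj i<k k<l l<j
interleaving {i} {j} {k} {l} i<j k<l (i≢k , i≢l , j≢k , j≢l) | tri> _ _ k<i with <-cmp l i
...   | tri< l<i _ _ = klij k<l l<i i<j
...   | tri≈ _ l≡i _ = ⊥-elim (i≢l (sym l≡i))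
...   | tri> _ _ i<l with <-cmp j l
...     | tri< j<l _ _ = kijl k<i i<j j<l
...     | tri≈ _ j≡l _ = ⊥-elim (j≢l j≡l)
...     | tri> _ _ l<j = kilj k<i i<l l<j

pairIdentities-disjoint : ∀ {a b} → Ordered a → Ordered b → Disjoint a b → PairIdentities a b
pairIdentities-disjoint {i , j} {k , l} i<j k<l a#b with interleaving i<j k<l a#b
... | ijkl u v w = OrderType.pairIdentities u v w 0F 1F 2F 3F (refl , refl)
... | ikjl u v w = OrderType.pairIdentities u v w 0F 2F 1F 3F (refl , refl)
... | iklj u v w = OrderType.pairIdentities u v w 0F 3F 1F 2F (refl , refl)
... | kijl u v w = OrderType.pairIdentities u v w 1F 2F 0F 3F (refl , refl)
... | kilj u v w = OrderType.pairIdentities u v w 1F 3F 0F 2F (refl , refl)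
... | klij u v w = OrderType.pairIdentities u v w 2F 3F 0F 1F (refl , refl)

-- The comparisons are abstracted simultaneously: after a first 'rewrite' the goal
-- is normalised and 'does (_ <? _)' no longer occurs in it.
enclosedEndpoints-self : ∀ {a} → Ordered a → enclosedEndpoints a a ≡ symmetrised crossing a a + 2 * nesting a a
enclosedEndpoints-self {i , j} i<j
  with does (i <? i) | ≥-false (≤-refl {i}) | does (j <? j) | ≥-false (≤-refl {j}) | does (i <? j) | <-true i<j
... | _ | refl | _ | refl | _ | refl = refl

relationCount-self : ∀ {a} → Ordered a → relationCount a a ≡ 0
relationCount-self {i , j} i<j
  with does (i <? i) | ≥-false (≤-refl {i}) | does (i <? j) | <-true i<j | does (j <? i) | ≥-false (<⇒≤ i<j)
... | _ | refl | _ | refl | _ | refl = refl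

vertices-unique : ∀ n → Unique (vertices n)
vertices-unique n = applyUpTo⁺₁ (λ k → k + 1) (2 * n) (λ i<j _ eq → <⇒≢ i<j (+-cancelʳ-≡ 1 _ _ eq))

endpoints-unique⇒disjoint : ∀ as → Unique (endpoints as) → AllPairs Disjoint as
endpoints-unique⇒disjoint []             _                         = []
endpoints-unique⇒disjoint ((i , j) ∷ as) ((_ ∷ i∉) ∷ (j∉ ∷ unique)) =
  disjointFrom as i∉ j∉ ∷ endpoints-unique⇒disjoint as unique
  where
  disjointFrom : ∀ bs → All (i ≢_) (endpoints bs) → All (j ≢_) (endpoints bs) → All (Disjoint (i , j)) bs
  disjointFrom []       _                  _                  = []
  disjointFrom (b ∷ bs) (i≢k ∷ i≢l ∷ i∉bs) (j≢k ∷ j≢l ∷ j∉bs) =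
    (i≢k , i≢l , j≢k , j≢l) ∷ disjointFrom bs i∉bs j∉bs

length-endpoints : ∀ as → length (endpoints as) ≡ 2 * length as
length-endpoints []       = refl
length-endpoints (a ∷ as) = trans (cong (2 +_) (length-endpoints as)) (sym (*-suc 2 (length as)))

∑-endpoints : ∀ as (f : ℕ → ℕ) → ∑ (endpoints as) f ≡ ∑[ b ∈ as ] (f (proj₁ b) + f (proj₂ b))
∑-endpoints as f = trans (∑-concatMap _ as f) (∑-cong as (λ b → cong (f (proj₁ b) +_) (+-identityʳ _)))

length-filter-pairs≡∑∑ : {P : Arc × Arc → Set} (P? : Decidable P) (as : List Arc) →
                         length (filter P? (pairs as)) ≡ ∑∑ as (λ a b → 𝟙 (does (P? (a , b))))
length-filter-pairs≡∑∑ P? as = trans (length-filter≡∑ P? (pairs as)) (∑-cartesianProduct as as _)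

∑∑-relationCount : ∀ as → ∑∑ as relationCount ≡ 2 * (∑∑ as crossing + ∑∑ as nesting + ∑∑ as alignment)
∑∑-relationCount as = begin
  ∑∑ as relationCount
    ≡⟨ ∑∑-+ as (λ a b → symmetrised crossing a b + symmetrised nesting a b) (symmetrised alignment) ⟩
  ∑∑ as (λ a b → symmetrised crossing a b + symmetrised nesting a b) + ∑∑ as (symmetrised alignment)
    ≡⟨ cong (_+ ∑∑ as (symmetrised alignment)) (∑∑-+ as (symmetrised crossing) (symmetrised nesting)) ⟩
  ∑∑ as (symmetrised crossing) + ∑∑ as (symmetrised nesting) + ∑∑ as (symmetrised alignment)
    ≡⟨ cong₂ _+_ (cong₂ _+_ (∑∑-symmetrised as crossing) (∑∑-symmetrised as nesting)) (∑∑-symmetrised as alignment) ⟩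
  2 * CR + 2 * NE + 2 * AL
    ≡⟨ cong (_+ 2 * AL) (sym (*-distribˡ-+ 2 CR NE)) ⟩
  2 * (CR + NE) + 2 * AL
    ≡⟨ sym (*-distribˡ-+ 2 (CR + NE) AL) ⟩
  2 * (CR + NE + AL) ∎
  where
  CR = ∑∑ as crossing
  NE = ∑∑ as nesting
  AL = ∑∑ as alignment

module _ {n : ℕ} (π : PM n) where

  private
    as = arcs π

  arcs-disjoint : AllPairs Disjoint as
  arcs-disjoint = endpoints-unique⇒disjoint as (Unique-resp-↭ (↭⇒↭ₛ (↭-sym (covers π))) (vertices-unique n))

  arcs-length : length as ≡ n
  arcs-length = *-cancelˡ-≡ (length as) n 2 (begin
    2 * length as             ≡⟨ sym (length-endpoints as) ⟩
    length (endpoints as)     ≡⟨ ↭-length (covers π) ⟩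
    length (vertices n)       ≡⟨ length-applyUpTo _ (2 * n) ⟩
    2 * n                     ∎)

  tvd≡∑∑enclosedEndpoints : tvd π ≡ ∑∑ as enclosedEndpoints
  tvd≡∑∑enclosedEndpoints = begin
    tvd π                                                 ≡⟨ ∑-cong (vertices n) (λ v → length-filter≡∑ _ as) ⟩
    ∑[ v ∈ vertices n ] ∑[ a ∈ as ] 𝟙 (encloses a v)      ≡⟨ ∑-comm (vertices n) as _ ⟩
    ∑[ a ∈ as ] ∑[ v ∈ vertices n ] 𝟙 (encloses a v)      ≡⟨ ∑-cong as (λ a → ∑-↭ _ (↭-sym (covers π))) ⟩
    ∑[ a ∈ as ] ∑[ v ∈ endpoints as ] 𝟙 (encloses a v)    ≡⟨ ∑-cong as (λ a → ∑-endpoints as _) ⟩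
    ∑∑ as enclosedEndpoints                               ∎

  cr≡∑∑crossing : cr π ≡ ∑∑ as crossing
  cr≡∑∑crossing = length-filter-pairs≡∑∑ _ as

  ne≡∑∑nesting : ne π ≡ ∑∑ as nesting
  ne≡∑∑nesting = length-filter-pairs≡∑∑ _ as

  al≡∑∑alignment : al π ≡ ∑∑ as alignment
  al≡∑∑alignment = length-filter-pairs≡∑∑ _ as

  tvd≡2[cr+ne] : tvd π ≡ 2 * (cr π + ne π)
  tvd≡2[cr+ne] = begin
    tvd π
      ≡⟨ tvd≡∑∑enclosedEndpoints ⟩
    ∑∑ as enclosedEndpoints
      ≡⟨ ∑∑-cong-pairwise Disjoint-sym enclosedEndpoints-self (λ oa ob a#b → proj₁ (pairIdentities-disjoint oa ob a#b))
                          (ordered π) arcs-disjoint ⟩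
    ∑∑ as (λ a b → symmetrised crossing a b + 2 * nesting a b)
      ≡⟨ ∑∑-+ as (symmetrised crossing) (λ a b → 2 * nesting a b) ⟩
    ∑∑ as (symmetrised crossing) + ∑∑ as (λ a b → 2 * nesting a b)
      ≡⟨ cong₂ _+_ (∑∑-symmetrised as crossing) (∑∑-*ˡ as 2 nesting) ⟩
    2 * ∑∑ as crossing + 2 * ∑∑ as nesting
      ≡⟨ sym (*-distribˡ-+ 2 (∑∑ as crossing) (∑∑ as nesting)) ⟩
    2 * (∑∑ as crossing + ∑∑ as nesting)
      ≡⟨ cong (2 *_) (sym (cong₂ _+_ cr≡∑∑crossing ne≡∑∑nesting)) ⟩
    2 * (cr π + ne π) ∎

  cr+ne+al≡nC2 : cr π + ne π + al π ≡ n C 2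
  cr+ne+al≡nC2 = *-cancelˡ-≡ _ _ 2 (begin
    2 * (cr π + ne π + al π)
      ≡⟨ cong (2 *_) (cong₂ _+_ (cong₂ _+_ cr≡∑∑crossing ne≡∑∑nesting) al≡∑∑alignment) ⟩
    2 * (∑∑ as crossing + ∑∑ as nesting + ∑∑ as alignment)
      ≡⟨ sym (∑∑-relationCount as) ⟩
    ∑∑ as relationCount
      ≡⟨ ∑∑-offDiagonalOnes Disjoint-sym relationCount-self (λ oa ob a#b → proj₂ (pairIdentities-disjoint oa ob a#b))
                            (ordered π) arcs-disjoint ⟩
    2 * (length as C 2)
      ≡⟨ cong (λ m → 2 * (m C 2)) arcs-length ⟩
    2 * (n C 2) ∎)

mainTheorem4 : (n : ℕ) (π : PM n) →
    (tvd π + 2 * al π ≡ 2 * (n C 2)) × (tvd π ≡ 2 * (cr π + ne π))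
mainTheorem4 n π = tvd+2al≡2nC2 , tvd≡2[cr+ne] π
  where
  tvd+2al≡2nC2 : tvd π + 2 * al π ≡ 2 * (n C 2)
  tvd+2al≡2nC2 = begin
    tvd π + 2 * al π             ≡⟨ cong (_+ 2 * al π) (tvd≡2[cr+ne] π) ⟩
    2 * (cr π + ne π) + 2 * al π ≡⟨ sym (*-distribˡ-+ 2 (cr π + ne π) (al π)) ⟩
    2 * (cr π + ne π + al π)     ≡⟨ cong (2 *_) (cr+ne+al≡nC2 π) ⟩
    2 * (n C 2)                  ∎
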